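{- If two polytopes $P_1,P_2\in\mathcal{A}$ share a non-trivial Minkowski summand (a Minkowski summand that is not a point), then $(P_1,P_2)$ is not a regular sequence.
   Context: $\mathcal{A}$: lattice polytopes with vertices in $\mathbb{Z}^n_{\ge0}$ plus $0_{\mathcal{A}}$; $\oplus$ = convex hull of union, $\odot$ = Minkowski sum, $0_{\mathcal{A}}$ additive identity and absorbing. $C(P_1)=\{R\odot P_1:R\in\mathcal{A}\}$ is the sub-semimodule generated by $P_1$. $(P_1,P_2)$ is regular if for every $Q\in\mathcal{A}$ with $Q\notin C(P_1)$, we have $Q\odot P_2\notin C(P_1)$. -}

module Defs where

open import Data.Nat using (ℕ; zero; suc)
open import Data.Fin using (Fin)
import Data.Fin as F
open import Data.Vec using (Vec; zipWith)
import Data.Vec as V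
open import Data.List using (List; []; _∷_; length; lookup; cartesianProductWith)
open import Data.Integer using (+_)
open import Data.Rational using (ℚ; 0ℚ; 1ℚ; _+_; _*_; _≤_; _/_)
import Data.Nat as N
open import Data.Product using (Σ; ∃; _×_; _,_)
open import Relation.Binary.PropositionalEquality using (_≡_; _≢_)
open import Relation.Nullary using (¬_)

Pt : ℕ → Set
Pt n = Vec ℕ n

-- An element of 𝒜 is represented by a finite list of lattice points, standing
-- for their convex hull; the empty list represents 0_𝒜 (the empty polytope).
𝒜 : ℕ → Set
𝒜 n = List (Pt n)

0𝒜 : ∀ {n} → 𝒜 n
0𝒜 = []

ℕ→ℚ : ℕ → ℚ
ℕ→ℚ k = (+ k) / 1

sumℚ : (k : ℕ) → (Fin k → ℚ) → ℚ
sumℚ zero    f = 0ℚ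
sumℚ (suc k) f = f F.zero + sumℚ k (λ i → f (F.suc i))

-- x lies in the convex hull of the points of L (convex combination; rational
-- weights suffice since all data are rational)
InConv : ∀ {n} → Pt n → 𝒜 n → Set
InConv {n} x L =
  Σ (Fin (length L) → ℚ) λ w →
    (∀ i → 0ℚ ≤ w i) ×
    (sumℚ (length L) w ≡ 1ℚ) ×
    (∀ (j : Fin n) →
       sumℚ (length L) (λ i → w i * ℕ→ℚ (V.lookup (lookup L i) j))
         ≡ ℕ→ℚ (V.lookup x j))

_⊆ₐ_ : ∀ {n} → 𝒜 n → 𝒜 n → Set
P ⊆ₐ Q = ∀ i → InConv (lookup P i) Q

_≈ₐ_ : ∀ {n} → 𝒜 n → 𝒜 n → Set
P ≈ₐ Q = (P ⊆ₐ Q) × (Q ⊆ₐ P)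

infix 4 _≈ₐ_ _⊆ₐ_
infixl 7 _⊙_

-- Minkowski sum (conv A + conv B = conv (A + B)); 0𝒜 is absorbing
_⊙_ : ∀ {n} → 𝒜 n → 𝒜 n → 𝒜 n
P ⊙ Q = cartesianProductWith (zipWith N._+_) P Q

InC : ∀ {n} → 𝒜 n → 𝒜 n → Set
InC {n} Q P₁ = ∃ λ (R : 𝒜 n) → Q ≈ₐ R ⊙ P₁

Regular : ∀ {n} → 𝒜 n → 𝒜 n → Set
Regular {n} P₁ P₂ = ∀ (Q : 𝒜 n) → ¬ InC Q P₁ → ¬ InC (Q ⊙ P₂) P₁

MinkowskiSummand : ∀ {n} → 𝒜 n → 𝒜 n → Set
MinkowskiSummand {n} S P = ∃ λ (R : 𝒜 n) → P ≈ₐ S ⊙ R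

NonTrivial : ∀ {n} → 𝒜 n → Set
NonTrivial {n} S = (S ≢ []) × ¬ (∃ λ (v : Pt n) → S ≈ₐ (v ∷ []))

-- Write P₁ = S ⊙ R₁ and P₂ = S ⊙ R₂. Then R₁ ⊙ P₂ = R₂ ⊙ P₁ lies in C(P₁), so it
-- suffices that R₁ ∉ C(P₁). As S is not a point, some s ∈ S has a coordinate
-- s_j > 0. If R₁ = R ⊙ P₁, compare the largest j-th coordinates on P₁ and R₁:
-- P₁ = S ⊙ R₁ gives max P₁ ≥ s_j + max R₁, and R₁ = R ⊙ P₁ gives
-- max R₁ ≥ max P₁ (all coordinates are non-negative), so s_j = 0.
module Submission where

open import Defs
open import Data.Nat using (ℕ)
open import Data.List using ([])
open import Relation.Binary.PropositionalEquality using (_≢_)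
open import Relation.Nullary using (¬_)

open import Algebra.Bundles using (Ring)
open import Data.Empty using (⊥-elim)
open import Data.Fin as F using (Fin)
import Data.Integer as ℤ
import Data.Integer.Properties as ℤP
open import Data.List using (List; _∷_; length; lookup)
import Data.List.Extrema
open import Data.List.Membership.Propositional using (_∈_)
open import Data.List.Membership.Propositional.Properties
  using (∈-lookup; ∈-cartesianProductWith⁺; ∈-cartesianProductWith⁻)
open import Data.List.Relation.Unary.All as All using (All)
open import Data.List.Relation.Unary.Any as Any using (here; there)
open import Data.List.Relation.Unary.Any.Properties using (lookup-index)
open import Data.Nat as N using (zero; suc)
import Data.Nat.Properties as NP
open import Data.Nat.Coprimality using (1-coprimeTo)
import Data.Nat.Coprimality as Coprime
open import Data.Product using (∃; ∃₂; _×_; _,_; proj₁; proj₂)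
open import Data.Rational using (ℚ; mkℚ; 0ℚ; 1ℚ; *≤*; _+_; _*_; _≤_; toℚᵘ; nonNegative)
import Data.Rational.Properties as ℚP
import Data.Rational.Unnormalised as ℚᵘ
import Data.Rational.Unnormalised.Properties as ℚᵘP
open import Data.Sum using (_⊎_; inj₁; inj₂; [_,_]′)
open import Data.Vec using (zipWith; replicate)
import Data.Vec as V
open import Data.Vec.Properties using (lookup-zipWith; zipWith-assoc; zipWith-comm)
open import Function using (_∘_; id)
open import Relation.Binary.PropositionalEquality
  using (_≡_; refl; sym; trans; cong; cong₂; subst; subst₂; module ≡-Reasoning)

open import Algebra.Properties.Semiring.Sum (Ring.semiring ℚP.+-*-ring)
  using (sum; sum-cong-≗; sum-replicate-zero; ∑-distrib-+; ∑-comm; *-distribˡ-sum; *-distribʳ-sum)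

private
  variable
    n k : ℕ

ℕ→ℚ≡mkℚ : ∀ a → ℕ→ℚ a ≡ mkℚ (ℤ.+ a) 0 (Coprime.sym (1-coprimeTo a))
ℕ→ℚ≡mkℚ a = ℚP.normalize-coprime (Coprime.sym (1-coprimeTo a))

ℕ→ℚ-+ : ∀ a b → ℕ→ℚ (a N.+ b) ≡ ℕ→ℚ a + ℕ→ℚ b
ℕ→ℚ-+ a b = ℚP.toℚᵘ-injective (begin
  toℚᵘ (ℕ→ℚ (a N.+ b))                    ≡⟨ toℚᵘ-ℕ→ℚ (a N.+ b) ⟩
  ℚᵘ.mkℚᵘ (ℤ.+ (a N.+ b)) 0               ≈⟨ ℚᵘ.*≡* (cong (ℤ._* ℤ.+ 1) +-as-fractions) ⟩
  ℚᵘ.mkℚᵘ (ℤ.+ a) 0 ℚᵘ.+ ℚᵘ.mkℚᵘ (ℤ.+ b) 0 ≡⟨ cong₂ ℚᵘ._+_ (toℚᵘ-ℕ→ℚ a) (toℚᵘ-ℕ→ℚ b) ⟨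
  toℚᵘ (ℕ→ℚ a) ℚᵘ.+ toℚᵘ (ℕ→ℚ b)          ≈⟨ ℚP.toℚᵘ-homo-+ (ℕ→ℚ a) (ℕ→ℚ b) ⟨
  toℚᵘ (ℕ→ℚ a + ℕ→ℚ b)                    ∎)
  where
  open ℚᵘP.≃-Reasoning
  toℚᵘ-ℕ→ℚ : ∀ c → toℚᵘ (ℕ→ℚ c) ≡ ℚᵘ.mkℚᵘ (ℤ.+ c) 0
  toℚᵘ-ℕ→ℚ c = cong toℚᵘ (ℕ→ℚ≡mkℚ c)
  +-as-fractions : ℤ.+ a ℤ.+ ℤ.+ b ≡ ℤ.+ a ℤ.* ℤ.+ 1 ℤ.+ ℤ.+ b ℤ.* ℤ.+ 1
  +-as-fractions = sym (cong₂ ℤ._+_ (ℤP.*-identityʳ (ℤ.+ a)) (ℤP.*-identityʳ (ℤ.+ b)))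

ℕ→ℚ-mono-≤ : ∀ {a b} → a N.≤ b → ℕ→ℚ a ≤ ℕ→ℚ b
ℕ→ℚ-mono-≤ {a} {b} a≤b rewrite ℕ→ℚ≡mkℚ a | ℕ→ℚ≡mkℚ b =
  *≤* (subst₂ ℤ._≤_ (sym (ℤP.*-identityʳ (ℤ.+ a))) (sym (ℤP.*-identityʳ (ℤ.+ b))) (ℤ.+≤+ a≤b))

ℕ→ℚ-cancel-≤ : ∀ {a b} → ℕ→ℚ a ≤ ℕ→ℚ b → a N.≤ b
ℕ→ℚ-cancel-≤ {a} {b} le rewrite ℕ→ℚ≡mkℚ a | ℕ→ℚ≡mkℚ b with le
... | *≤* a*1≤b*1 rewrite ℤP.*-identityʳ (ℤ.+ a) | ℤP.*-identityʳ (ℤ.+ b) = ℤP.drop‿+≤+ a*1≤b*1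

coord : Pt n → Fin n → ℚ
coord x j = ℕ→ℚ (V.lookup x j)

sumℚ≡sum : ∀ k (f : Fin k → ℚ) → sumℚ k f ≡ sum f
sumℚ≡sum zero    f = refl
sumℚ≡sum (suc k) f = cong (f F.zero +_) (sumℚ≡sum k (f ∘ F.suc))

record IsConvexCombination (w : Fin k → ℚ) (y : Fin k → Pt n) (x : Pt n) : Set where
  constructor isConvexCombination
  field
    nonNeg     : ∀ i → 0ℚ ≤ w i
    total      : sum w ≡ 1ℚ
    barycentre : ∀ j → sum (λ i → w i * coord (y i) j) ≡ coord x j

open IsConvexCombination

fromInConv : ∀ {x : Pt n} {L} → InConv x L → ∃ λ w → IsConvexCombination w (lookup L) x
fromInConv {L = L} (w , w≥0 , Σw≡1 , Σwy≡x) =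
  w , isConvexCombination w≥0 (trans (sym (sumℚ≡sum _ w)) Σw≡1)
        (λ j → trans (sym (sumℚ≡sum (length L) _)) (Σwy≡x j))

toInConv : ∀ {x : Pt n} {L w} → IsConvexCombination w (lookup L) x → InConv x L
toInConv {L = L} {w} (isConvexCombination w≥0 Σw≡1 Σwy≡x) =
  w , w≥0 , trans (sumℚ≡sum _ w) Σw≡1 , λ j → trans (sumℚ≡sum (length L) _) (Σwy≡x j)

sum-mono-≤ : ∀ {f g : Fin k → ℚ} → (∀ i → f i ≤ g i) → sum f ≤ sum g
sum-mono-≤ {zero}  f≤g = ℚP.≤-refl
sum-mono-≤ {suc k} f≤g = ℚP.+-mono-≤ (f≤g F.zero) (sum-mono-≤ (f≤g ∘ F.suc))

sum-nonNeg : ∀ {f : Fin k → ℚ} → (∀ i → 0ℚ ≤ f i) → 0ℚ ≤ sum f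
sum-nonNeg {k} {f} 0≤f = subst (_≤ sum f) (sum-replicate-zero k) (sum-mono-≤ 0≤f)

*-nonNeg : ∀ {a b} → 0ℚ ≤ a → 0ℚ ≤ b → 0ℚ ≤ a * b
*-nonNeg {a} {b} 0≤a 0≤b =
  subst (_≤ a * b) (ℚP.*-zeroˡ b) (ℚP.*-monoʳ-≤-nonNeg b {{nonNegative 0≤b}} 0≤a)

sum-weighted-const : ∀ {w : Fin k → ℚ} → sum w ≡ 1ℚ → ∀ c → sum (λ i → w i * c) ≡ c
sum-weighted-const {w = w} Σw≡1 c = begin
  sum (λ i → w i * c) ≡⟨ *-distribʳ-sum c w ⟨
  sum w * c           ≡⟨ cong (_* c) Σw≡1 ⟩
  1ℚ * c              ≡⟨ ℚP.*-identityˡ c ⟩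
  c                   ∎
  where open ≡-Reasoning

δ : Fin k → Fin k → ℚ
δ F.zero    F.zero    = 1ℚ
δ F.zero    (F.suc _) = 0ℚ
δ (F.suc _) F.zero    = 0ℚ
δ (F.suc a) (F.suc i) = δ a i

δ-nonNeg : ∀ (a i : Fin k) → 0ℚ ≤ δ a i
δ-nonNeg F.zero    F.zero    = ℚP.nonNegative⁻¹ 1ℚ
δ-nonNeg F.zero    (F.suc i) = ℚP.≤-refl
δ-nonNeg (F.suc a) F.zero    = ℚP.≤-refl
δ-nonNeg (F.suc a) (F.suc i) = δ-nonNeg a i

sum-δ-* : ∀ (a : Fin k) (g : Fin k → ℚ) → sum (λ i → δ a i * g i) ≡ g a
sum-δ-* {suc k} F.zero g = begin
  1ℚ * g F.zero + sum (λ i → 0ℚ * g (F.suc i))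
    ≡⟨ cong₂ _+_ (ℚP.*-identityˡ (g F.zero)) (sum-cong-≗ (λ i → ℚP.*-zeroˡ (g (F.suc i)))) ⟩
  g F.zero + sum (λ (_ : Fin k) → 0ℚ)
    ≡⟨ cong (g F.zero +_) (sum-replicate-zero k) ⟩
  g F.zero + 0ℚ
    ≡⟨ ℚP.+-identityʳ (g F.zero) ⟩
  g F.zero ∎
  where open ≡-Reasoning
sum-δ-* {suc k} (F.suc a) g =
  trans (cong₂ _+_ (ℚP.*-zeroˡ (g F.zero)) (sum-δ-* a (g ∘ F.suc))) (ℚP.+-identityˡ (g (F.suc a)))

sum-δ : ∀ (a : Fin k) → sum (δ a) ≡ 1ℚ
sum-δ a = trans (sum-cong-≗ (λ i → sym (ℚP.*-identityʳ (δ a i)))) (sum-δ-* a (λ _ → 1ℚ))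

InConv-lookup : ∀ (L : 𝒜 n) (a : Fin (length L)) → InConv (lookup L a) L
InConv-lookup L a = toInConv {x = lookup L a} {L} {δ a}
  (isConvexCombination (δ-nonNeg a) (sum-δ a) (λ j → sum-δ-* a (λ i → coord (lookup L i) j)))

InConv-∈ : ∀ {x : Pt n} {L} → x ∈ L → InConv x L
InConv-∈ {L = L} x∈L =
  subst (λ z → InConv z L) (sym (lookup-index x∈L)) (InConv-lookup L (Any.index x∈L))

InConv-convex : ∀ {Q : 𝒜 n} {w : Fin k → ℚ} {y x} →
  IsConvexCombination w y x → (∀ i → InConv (y i) Q) → InConv x Q
InConv-convex {n} {k} {Q} {w} {y} {x} (isConvexCombination w≥0 Σw≡1 Σwy≡x) y∈Q =
  toInConv {x = x} {Q} (isConvexCombination v≥0 Σv≡1 Σvq≡x)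
  where
  open ≡-Reasoning
  u : Fin k → Fin (length Q) → ℚ
  u i = proj₁ (fromInConv {x = y i} {Q} (y∈Q i))
  u-convex : ∀ i → IsConvexCombination (u i) (lookup Q) (y i)
  u-convex i = proj₂ (fromInConv {x = y i} {Q} (y∈Q i))
  v : Fin (length Q) → ℚ
  v l = sum (λ i → w i * u i l)
  v≥0 : ∀ l → 0ℚ ≤ v l
  v≥0 l = sum-nonNeg (λ i → *-nonNeg (w≥0 i) (nonNeg (u-convex i) l))
  reorder : (c : Fin (length Q) → ℚ) →
    sum (λ l → v l * c l) ≡ sum (λ i → w i * sum (λ l → u i l * c l))
  reorder c = begin
    sum (λ l → v l * c l)
      ≡⟨ sum-cong-≗ (λ l → *-distribʳ-sum (c l) (λ i → w i * u i l)) ⟩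
    sum (λ l → sum (λ i → w i * u i l * c l))
      ≡⟨ ∑-comm (λ i l → w i * u i l * c l) ⟨
    sum (λ i → sum (λ l → w i * u i l * c l))
      ≡⟨ sum-cong-≗ (λ i → trans (sum-cong-≗ (λ l → ℚP.*-assoc (w i) (u i l) (c l)))
                                 (sym (*-distribˡ-sum (w i) (λ l → u i l * c l)))) ⟩
    sum (λ i → w i * sum (λ l → u i l * c l)) ∎
  Σv≡1 : sum v ≡ 1ℚ
  Σv≡1 = begin
    sum v                                      ≡⟨ sum-cong-≗ (λ l → sym (ℚP.*-identityʳ (v l))) ⟩
    sum (λ l → v l * 1ℚ)                       ≡⟨ reorder (λ _ → 1ℚ) ⟩
    sum (λ i → w i * sum (λ l → u i l * 1ℚ))   ≡⟨ sum-cong-≗ (λ i → cong (w i *_) (Σu*1≡1 i)) ⟩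
    sum (λ i → w i * 1ℚ)                       ≡⟨ sum-weighted-const {w = w} Σw≡1 1ℚ ⟩
    1ℚ                                         ∎
    where
    Σu*1≡1 : ∀ i → sum (λ l → u i l * 1ℚ) ≡ 1ℚ
    Σu*1≡1 i = trans (sum-cong-≗ (λ l → ℚP.*-identityʳ (u i l))) (total (u-convex i))
  Σvq≡x : ∀ j → sum (λ l → v l * coord (lookup Q l) j) ≡ coord x j
  Σvq≡x j = begin
    sum (λ l → v l * coord (lookup Q l) j)
      ≡⟨ reorder (λ l → coord (lookup Q l) j) ⟩
    sum (λ i → w i * sum (λ l → u i l * coord (lookup Q l) j))
      ≡⟨ sum-cong-≗ (λ i → cong (w i *_) (barycentre (u-convex i) j)) ⟩
    sum (λ i → w i * coord (y i) j)
      ≡⟨ Σwy≡x j ⟩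
    coord x j ∎

InConv-⊆ₐ : ∀ {x : Pt n} {P Q} → InConv x P → P ⊆ₐ Q → InConv x Q
InConv-⊆ₐ {x = x} {P} {Q} x∈P P⊆Q = InConv-convex {Q = Q} (proj₂ (fromInConv {x = x} {P} x∈P)) P⊆Q

⊆ₐ-intro : ∀ {P Q : 𝒜 n} → (∀ {x} → x ∈ P → InConv x Q) → P ⊆ₐ Q
⊆ₐ-intro P⊆Q i = P⊆Q (∈-lookup i)

⊆ₐ-elim : ∀ {P Q : 𝒜 n} → P ⊆ₐ Q → ∀ {x} → x ∈ P → InConv x Q
⊆ₐ-elim {Q = Q} P⊆Q x∈P = subst (λ z → InConv z Q) (sym (lookup-index x∈P)) (P⊆Q (Any.index x∈P))

⊆ₐ-trans : ∀ {P Q R : 𝒜 n} → P ⊆ₐ Q → Q ⊆ₐ R → P ⊆ₐ R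
⊆ₐ-trans {P = P} {Q} {R} P⊆Q Q⊆R i = InConv-⊆ₐ {x = lookup P i} {Q} {R} (P⊆Q i) Q⊆R

≢[]⇒∃∈ : ∀ {A : Set} {L : List A} → L ≢ [] → ∃ (_∈ L)
≢[]⇒∃∈ {L = []}    L≢[] = ⊥-elim (L≢[] refl)
≢[]⇒∃∈ {L = x ∷ _} _    = x , here refl

InConv-nonEmpty : ∀ {x : Pt n} {L} → InConv x L → ∃ (_∈ L)
InConv-nonEmpty {L = []}    (_ , _ , () , _)
InConv-nonEmpty {L = y ∷ _} _ = y , here refl

_+ᵥ_ : Pt n → Pt n → Pt n
_+ᵥ_ = zipWith N._+_

coord-+ᵥ : ∀ (a b : Pt n) j → coord (a +ᵥ b) j ≡ coord a j + coord b j
coord-+ᵥ a b j = trans (cong ℕ→ℚ (lookup-zipWith N._+_ j a b)) (ℕ→ℚ-+ (V.lookup a j) (V.lookup b j))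

+ᵥ-rotate : ∀ (a b c : Pt n) → a +ᵥ (b +ᵥ c) ≡ c +ᵥ (b +ᵥ a)
+ᵥ-rotate a b c = begin
  a +ᵥ (b +ᵥ c) ≡⟨ zipWith-assoc NP.+-assoc a b c ⟨
  (a +ᵥ b) +ᵥ c ≡⟨ zipWith-comm NP.+-comm (a +ᵥ b) c ⟩
  c +ᵥ (a +ᵥ b) ≡⟨ cong (c +ᵥ_) (zipWith-comm NP.+-comm a b) ⟩
  c +ᵥ (b +ᵥ a) ∎
  where open ≡-Reasoning

∈-⊙⁺ : ∀ {A B : 𝒜 n} {a b} → a ∈ A → b ∈ B → a +ᵥ b ∈ A ⊙ B
∈-⊙⁺ = ∈-cartesianProductWith⁺ _+ᵥ_

∈-⊙⁻ : ∀ (A B : 𝒜 n) {x} → x ∈ A ⊙ B → ∃₂ λ a b → a ∈ A × b ∈ B × x ≡ a +ᵥ b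
∈-⊙⁻ = ∈-cartesianProductWith⁻ _+ᵥ_

IsConvexCombination-translate : ∀ (a : Pt n) {w : Fin k → ℚ} {y x} →
  IsConvexCombination w y x → IsConvexCombination w (λ i → a +ᵥ y i) (a +ᵥ x)
IsConvexCombination-translate a {w} {y} {x} (isConvexCombination w≥0 Σw≡1 Σwy≡x) =
  isConvexCombination w≥0 Σw≡1 λ j → begin
  sum (λ i → w i * coord (a +ᵥ y i) j)
    ≡⟨ sum-cong-≗ (λ i → trans (cong (w i *_) (coord-+ᵥ a (y i) j)) (ℚP.*-distribˡ-+ (w i) _ _)) ⟩
  sum (λ i → w i * coord a j + w i * coord (y i) j)
    ≡⟨ ∑-distrib-+ (λ i → w i * coord a j) (λ i → w i * coord (y i) j) ⟩
  sum (λ i → w i * coord a j) + sum (λ i → w i * coord (y i) j)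
    ≡⟨ cong₂ _+_ (sum-weighted-const {w = w} Σw≡1 (coord a j)) (Σwy≡x j) ⟩
  coord a j + coord x j
    ≡⟨ coord-+ᵥ a x j ⟨
  coord (a +ᵥ x) j ∎
  where open ≡-Reasoning

InConv-translate : ∀ {A P : 𝒜 n} {a p} → a ∈ A → InConv p P → InConv (a +ᵥ p) (A ⊙ P)
InConv-translate {A = A} {P} {a} {p} a∈A p∈P =
  InConv-convex {Q = A ⊙ P} (IsConvexCombination-translate a (proj₂ (fromInConv {x = p} {P} p∈P)))
                (λ i → InConv-∈ (∈-⊙⁺ a∈A (∈-lookup i)))

⊙-⊆ₐ-intro : ∀ {A B C : 𝒜 n} → (∀ {a b} → a ∈ A → b ∈ B → InConv (a +ᵥ b) C) → A ⊙ B ⊆ₐ C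
⊙-⊆ₐ-intro {A = A} {B} {C} AB⊆C = ⊆ₐ-intro {P = A ⊙ B} {C} λ x∈AB →
  let _ , _ , a∈A , b∈B , x≡a+b = ∈-⊙⁻ A B x∈AB
  in subst (λ z → InConv z C) (sym x≡a+b) (AB⊆C a∈A b∈B)

⊙-monoʳ-⊆ₐ : ∀ (B : 𝒜 n) {P P'} → P ⊆ₐ P' → B ⊙ P ⊆ₐ B ⊙ P'
⊙-monoʳ-⊆ₐ B {P} {P'} P⊆P' = ⊙-⊆ₐ-intro {A = B} {P} {B ⊙ P'} λ b∈B p∈P →
  InConv-translate {A = B} {P'} b∈B (⊆ₐ-elim {P = P} {P'} P⊆P' p∈P)

⊙-rotate-⊆ₐ : ∀ (S R₁ R₂ : 𝒜 n) → R₁ ⊙ (S ⊙ R₂) ⊆ₐ R₂ ⊙ (S ⊙ R₁)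
⊙-rotate-⊆ₐ S R₁ R₂ = ⊙-⊆ₐ-intro {A = R₁} {S ⊙ R₂} {R₂ ⊙ (S ⊙ R₁)} λ {r₁} r₁∈R₁ y∈SR₂ →
  let s , r₂ , s∈S , r₂∈R₂ , y≡s+r₂ = ∈-⊙⁻ S R₂ y∈SR₂
  in subst (λ z → InConv z (R₂ ⊙ (S ⊙ R₁)))
           (sym (trans (cong (r₁ +ᵥ_) y≡s+r₂) (+ᵥ-rotate r₁ s r₂)))
           (InConv-∈ (∈-⊙⁺ r₂∈R₂ (∈-⊙⁺ s∈S r₁∈R₁)))

summand-exchange : ∀ (S R₁ R₂ P₁ P₂ : 𝒜 n) →
  P₂ ⊆ₐ S ⊙ R₂ → S ⊙ R₁ ⊆ₐ P₁ → R₁ ⊙ P₂ ⊆ₐ R₂ ⊙ P₁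
summand-exchange S R₁ R₂ P₁ P₂ P₂⊆SR₂ SR₁⊆P₁ =
  ⊆ₐ-trans {P = R₁ ⊙ P₂} {R₁ ⊙ (S ⊙ R₂)} {R₂ ⊙ P₁} (⊙-monoʳ-⊆ₐ R₁ {P₂} {S ⊙ R₂} P₂⊆SR₂)
    (⊆ₐ-trans {P = R₁ ⊙ (S ⊙ R₂)} {R₂ ⊙ (S ⊙ R₁)} {R₂ ⊙ P₁}
      (⊙-rotate-⊆ₐ S R₁ R₂) (⊙-monoʳ-⊆ₐ R₂ {S ⊙ R₁} {P₁} SR₁⊆P₁))

common-summand⇒InC : ∀ (S R₁ R₂ P₁ P₂ : 𝒜 n) →
  P₁ ≈ₐ S ⊙ R₁ → P₂ ≈ₐ S ⊙ R₂ → InC (R₁ ⊙ P₂) P₁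
common-summand⇒InC S R₁ R₂ P₁ P₂ (P₁⊆ , ⊆P₁) (P₂⊆ , ⊆P₂) =
  R₂ , summand-exchange S R₁ R₂ P₁ P₂ P₂⊆ ⊆P₁ , summand-exchange S R₂ R₁ P₂ P₁ P₁⊆ ⊆P₂

InConv-lookup-≤ : ∀ {x : Pt n} {L} j {b} →
  InConv x L → (∀ {y} → y ∈ L → V.lookup y j N.≤ b) → V.lookup x j N.≤ b
InConv-lookup-≤ {x = x} {L} j {b} x∈L L≤b with fromInConv {x = x} {L} x∈L
... | w , isConvexCombination w≥0 Σw≡1 Σwy≡x = ℕ→ℚ-cancel-≤ (begin
  coord x j                                ≡⟨ Σwy≡x j ⟨
  sum (λ i → w i * coord (lookup L i) j)   ≤⟨ sum-mono-≤ weighted-≤ ⟩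
  sum (λ i → w i * ℕ→ℚ b)                  ≡⟨ sum-weighted-const {w = w} Σw≡1 (ℕ→ℚ b) ⟩
  ℕ→ℚ b                                    ∎)
  where
  open ℚP.≤-Reasoning
  weighted-≤ : ∀ i → w i * coord (lookup L i) j ≤ w i * ℕ→ℚ b
  weighted-≤ i = ℚP.*-monoˡ-≤-nonNeg (w i) {{nonNegative (w≥0 i)}} (ℕ→ℚ-mono-≤ (L≤b (∈-lookup i)))

⊙⊆ₐ⇒lookup-+-≤ : ∀ {A B C : 𝒜 n} {a b} j {m} → A ⊙ B ⊆ₐ C → a ∈ A → b ∈ B →
  (∀ {z} → z ∈ C → V.lookup z j N.≤ m) → V.lookup a j N.+ V.lookup b j N.≤ m
⊙⊆ₐ⇒lookup-+-≤ {A = A} {B} {C} {a} {b} j AB⊆C a∈A b∈B C≤m =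
  subst (N._≤ _) (lookup-zipWith N._+_ j a b)
    (InConv-lookup-≤ {x = a +ᵥ b} {C} j (⊆ₐ-elim {P = A ⊙ B} {C} AB⊆C (∈-⊙⁺ a∈A b∈B)) C≤m)

∃-highest : ∀ j {x : Pt n} {L} → x ∈ L →
  ∃ λ t → t ∈ L × ∀ {y} → y ∈ L → V.lookup y j N.≤ V.lookup t j
∃-highest j {L = z ∷ L} _ = argmax f z L , argmax-all f (here refl) (All.tabulate there) , maximal
  where
  open Data.List.Extrema NP.≤-totalOrder using (argmax; argmax-all; f[⊥]≤f[argmax]; f[xs]≤f[argmax])
  f : Pt _ → ℕ
  f y = V.lookup y j
  maximal : ∀ {y} → y ∈ z ∷ L → f y N.≤ f (argmax f z L)
  maximal (here refl)  = f[⊥]≤f[argmax] {f = f} z L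
  maximal (there y∈L) = All.lookup (f[xs]≤f[argmax] {f = f} z L) y∈L

m+n≤o⇒p+o≤n⇒m≡0 : ∀ {m n o p} → m N.+ n N.≤ o → p N.+ o N.≤ n → m ≡ 0
m+n≤o⇒p+o≤n⇒m≡0 {m} {n} {o} {p} m+n≤o p+o≤n =
  NP.n≤0⇒n≡0 (NP.+-cancelʳ-≤ n m 0 (NP.≤-trans m+n≤o (NP.≤-trans (NP.m≤n+m o p) p+o≤n)))

InConv-⊙-nonEmpty : ∀ {x : Pt n} {A B} → InConv x (A ⊙ B) → ∃ (_∈ A) × ∃ (_∈ B)
InConv-⊙-nonEmpty {x = x} {A} {B} x∈AB
  with ∈-⊙⁻ A B (proj₂ (InConv-nonEmpty {x = x} {A ⊙ B} x∈AB))
... | a , b , a∈A , b∈B , _ = (a , a∈A) , (b , b∈B)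

summand-lookup≢0⇒¬InC : ∀ (S R₁ P₁ : 𝒜 n) {s p} j → s ∈ S → V.lookup s j ≢ 0 → p ∈ P₁ →
  P₁ ≈ₐ S ⊙ R₁ → ¬ InC R₁ P₁
summand-lookup≢0⇒¬InC S R₁ P₁ {s} {p} j s∈S sⱼ≢0 p∈P₁ (P₁⊆SR₁ , SR₁⊆P₁) (R , R₁⊆RP₁ , RP₁⊆R₁) =
  let _ , r₁∈R₁           = proj₂ (InConv-⊙-nonEmpty {x = p} {S} {R₁}
                                     (⊆ₐ-elim {P = P₁} {S ⊙ R₁} P₁⊆SR₁ p∈P₁))
      t , t∈R₁ , t-highest = ∃-highest j r₁∈R₁
      u , u∈P₁ , u-highest = ∃-highest j p∈P₁
      _ , r∈R             = proj₁ (InConv-⊙-nonEmpty {x = t} {R} {P₁}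
                                     (⊆ₐ-elim {P = R₁} {R ⊙ P₁} R₁⊆RP₁ t∈R₁))
  in sⱼ≢0 (m+n≤o⇒p+o≤n⇒m≡0
       (⊙⊆ₐ⇒lookup-+-≤ {A = S} {R₁} {P₁} j SR₁⊆P₁ s∈S t∈R₁ u-highest)
       (⊙⊆ₐ⇒lookup-+-≤ {A = R} {P₁} {R₁} j RP₁⊆R₁ r∈R u∈P₁ t-highest))

nonzero-lookup-or-zero : ∀ (v : Pt n) → (∃ λ j → V.lookup v j ≢ 0) ⊎ v ≡ replicate n 0
nonzero-lookup-or-zero V.[]           = inj₂ refl
nonzero-lookup-or-zero (suc _ V.∷ v) = inj₁ (F.zero , λ ())
nonzero-lookup-or-zero (zero V.∷ v) with nonzero-lookup-or-zero v
... | inj₁ (j , vⱼ≢0) = inj₁ (F.suc j , vⱼ≢0)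
... | inj₂ v≡0       = inj₂ (cong (0 V.∷_) v≡0)

nonzero-lookup-or-origin : ∀ (L : 𝒜 n) →
  (∃₂ λ s j → s ∈ L × V.lookup s j ≢ 0) ⊎ All (_≡ replicate n 0) L
nonzero-lookup-or-origin []      = inj₂ All.[]
nonzero-lookup-or-origin (x ∷ L) with nonzero-lookup-or-zero x | nonzero-lookup-or-origin L
... | inj₁ (j , xⱼ≢0)          | _         = inj₁ (x , j , here refl , xⱼ≢0)
... | inj₂ _                   | inj₁ (s , j , s∈L , sⱼ≢0) = inj₁ (s , j , there s∈L , sⱼ≢0)
... | inj₂ x≡0                 | inj₂ L≡0  = inj₂ (x≡0 All.∷ L≡0)

origin-only⇒≈origin : ∀ {s : Pt n} {S} →
  All (_≡ replicate n 0) (s ∷ S) → s ∷ S ≈ₐ replicate n 0 ∷ []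
origin-only⇒≈origin {n} {s} {S} all≡0@(s≡0 All.∷ _) =
  ⊆ₐ-intro {P = s ∷ S} {origin} (λ x∈ → InConv-∈ {L = origin} (here (All.lookup all≡0 x∈))) ,
  ⊆ₐ-intro {P = origin} {s ∷ S} λ { (here refl) → InConv-∈ {L = s ∷ S} (here (sym s≡0)) }
  where
  origin : 𝒜 n
  origin = replicate n 0 ∷ []

NonTrivial⇒nonzero-lookup : ∀ {S : 𝒜 n} → NonTrivial S → ∃₂ λ s j → s ∈ S × V.lookup s j ≢ 0
NonTrivial⇒nonzero-lookup {S = []}    (S≢[] , _) = ⊥-elim (S≢[] refl)
NonTrivial⇒nonzero-lookup {S = s ∷ S} (_ , S≉point) =
  [ id , (λ all≡0 → ⊥-elim (S≉point (replicate _ 0 , origin-only⇒≈origin all≡0))) ]′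
    (nonzero-lookup-or-origin (s ∷ S))

mainTheorem12 : (n : ℕ) (P₁ P₂ : 𝒜 n) → P₁ ≢ [] → P₂ ≢ [] →
                (S : 𝒜 n) → NonTrivial S →
                MinkowskiSummand S P₁ → MinkowskiSummand S P₂ →
                ¬ Regular P₁ P₂
mainTheorem12 n P₁ P₂ P₁≢[] _ S S-nonTrivial (R₁ , P₁≈SR₁) (R₂ , P₂≈SR₂) regular =
  let s , j , s∈S , sⱼ≢0 = NonTrivial⇒nonzero-lookup S-nonTrivial
      p , p∈P₁           = ≢[]⇒∃∈ P₁≢[]
  in regular R₁ (summand-lookup≢0⇒¬InC S R₁ P₁ j s∈S sⱼ≢0 p∈P₁ P₁≈SR₁)
                (common-summand⇒InC S R₁ R₂ P₁ P₂ P₁≈SR₁ P₂≈SR₂)
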